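{- Let $\mathcal I$ be a small step alternating pushdown system and let $\mathcal I_{\neg}$ and $\mathcal I'_{\neg}$ be as defined below. For every configuration $A$, the proposition $\neg A$ has a (finite) proof in $\mathcal I'_{\neg}$ if and only if it has a co-inductive proof in $\mathcal I_{\neg}$.
   Context: Fix a language with finitely many unary predicate symbols (states), finitely many unary function symbols (stack symbols), a constant $\varepsilon$ and a variable $x$. Words are closed terms $\gamma_1(\cdots\gamma_n(\varepsilon))$; configurations are atomic propositions $P(w)$ with $P$ a state and $w$ a word. Besides atomic propositions we use formal negations $\neg A$. For an inference system $\mathcal J$ (a set of rules with finitely many premises, each premise and the conclusion being an atomic proposition or its negation, possibly containing $x$), a proof of a closed proposition $C$ is a finite tree with root $C$ in which each node is labeled $\sigma B$ and its children $\sigma A_1,\dots,\sigma A_n$ for some rule $\frac{A_1\cdots A_n}{B}\in\mathcal J$ and substitution $\sigma$ of a word for $x$; a co-inductive proof is the same with possibly infinite trees. Rule types: an introduction rule is $\frac{P_1(x)\cdots P_n(x)}{Q(\gamma x)}$ ($\gamma$ a stack symbol, $n\ge0$) or $\frac{}{Q(\varepsilon)}$; an elimination rule is $\frac{P_1(\gamma x)\ P_2(x)\cdots P_n(x)}{Q(x)}$ ($n\ge1$); a neutral rule is $\frac{P_1(x)\cdots P_n(x)}{Q(x)}$ ($n\ge0$). A small step alternating pushdown system is a finite set of introduction, elimination and neutral rules; premises of rules are regarded as sets. Saturation: $\mathcal I_s$ is the smallest set of rules containing $\mathcal I$ and closed under (1) from an introduction rule $\frac{P_1(x)\cdots P_m(x)}{Q_1(\gamma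 x)}$ and an elimination rule $\frac{Q_1(\gamma x)\ Q_2(x)\cdots Q_n(x)}{R(x)}$, add $\frac{P_1(x)\cdots P_m(x)\ Q_2(x)\cdots Q_n(x)}{R(x)}$; (2) from introduction rules $\frac{P^i_1(x)\cdots P^i_{m_i}(x)}{Q_i(\gamma x)}$ ($i=1..n$, same $\gamma$) and a neutral rule $\frac{Q_1(x)\cdots Q_n(x)}{R(x)}$ ($n\ge0$), add $\frac{P^1_1(x)\cdots P^n_{m_n}(x)}{R(\gamma x)}$ (all premises together; for $n=0$, $\frac{}{R(\gamma x)}$ for every $\gamma$); (3) from introduction rules $\frac{}{Q_i(\varepsilon)}$ ($i=1..n$) and a neutral rule $\frac{Q_1(x)\cdots Q_n(x)}{R(x)}$ ($n\ge0$), add $\frac{}{R(\varepsilon)}$. $\mathcal I'$ is the alternating multi-automaton obtained from $\mathcal I_s$ by removing all elimination and neutral rules. For a small step system $\mathcal J$: $\tilde{\mathcal J}$ keeps the introduction rules of $\mathcal J$ and replaces each neutral or elimination rule (conclusion $P(x)$) by its instance with $x:=\varepsilon$ and its instances with $x:=\gamma x$ for every stack symbol $\gamma$; $\mathcal C$ is the set of all $P(\varepsilon)$, $P(\gamma x)$. Then $\mathcal J_{\neg}$ consists of the rules of $\mathcal J$ together with, for each $B\in\mathcal C$, letting $r_1,\dots,r_n$ ($n\ge0$) be the rules of $\tilde{\mathcal J}$ with conclusion $B$ and $A^i_1,\dots,A^i_{m_i}$ the premises of $r_i$, all rules $\frac{\neg A^1_{j_1}\ \cdots\ \neg A^n_{j_n}}{\neg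 B}$ for $1\le j_i\le m_i$ (the single rule $\frac{}{\neg B}$ if $n=0$). $\mathcal I_{\neg}$ and $\mathcal I'_{\neg}$ are this construction applied to $\mathcal J=\mathcal I$ and $\mathcal J=\mathcal I'$ respectively. -}

module Defs where

open import Data.Nat using (ℕ)
open import Data.Fin using (Fin; toℕ)
open import Data.Maybe using (Maybe; just)
open import Data.Fin.Subset using (Subset; _∈_; _∪_; ⋃)
open import Data.Fin.Subset.Properties using (_∈?_)
open import Data.List using (List; []; _∷_; map; filter; allFin; length; lookup)
open import Data.List.Relation.Unary.All using (All)
open import Data.List.Membership.Propositional renaming (_∈_ to _∈ₗ_)
open import Data.Product using (Σ; _×_; _,_; proj₁; proj₂)
open import Data.Sum using (_⊎_)
open import Data.Unit using (⊤)
open import Data.Empty using (⊥)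
open import Relation.Nullary using (¬_)
open import Relation.Binary.PropositionalEquality using (_≡_)

-- Language: states are Fin n, stack symbols are Fin k.

data Tm (k : ℕ) : Set where
  ε   : Tm k
  x   : Tm k
  _∙_ : Fin k → Tm k → Tm k

-- Words (closed terms): γ₁ ∷ … ∷ γₘ ∷ []  stands for γ₁(⋯γₘ(ε))
Word : ℕ → Set
Word k = List (Fin k)

data Prop (n : ℕ) (T : Set) : Set where
  atom  : Fin n → T → Prop n T
  ¬atom : Fin n → T → Prop n T

mapProp : ∀ {n} {T U : Set} → (T → U) → Prop n T → Prop n U
mapProp f (atom P t)  = atom P (f t)
mapProp f (¬atom P t) = ¬atom P (f t)

record Rule (n k : ℕ) : Set where
  constructor _⊢_
  field
    prem  : List (Prop n (Tm k))
    concl : Prop n (Tm k)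
open Rule public

InferenceSystem : ℕ → ℕ → Set₁
InferenceSystem n k = Rule n k → Set

subW : ∀ {k} → Word k → Tm k → Word k
subW w ε       = []
subW w x       = w
subW w (γ ∙ t) = γ ∷ subW w t

subT : ∀ {k} → Tm k → Tm k → Tm k
subT t ε       = ε
subT t x       = t
subT t (γ ∙ s) = γ ∙ subT t s

instRule : ∀ {n k} → Tm k → Rule n k → Rule n k
instRule t r = map (mapProp (subT t)) (prem r) ⊢ mapProp (subT t) (concl r)

data Proof {n k} (J : InferenceSystem n k) : Prop n (Word k) → Set where
  node : ∀ {C} (r : Rule n k) → J r → (σ : Word k) →
         mapProp (subW σ) (concl r) ≡ C →
         All (Proof J) (map (mapProp (subW σ)) (prem r)) →
         Proof J C

Node : ∀ {n k} → InferenceSystem n k → Set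
Node {n} {k} J = Σ (Rule n k) J × Word k

nodeConcl : ∀ {n k} {J : InferenceSystem n k} → Node J → Prop n (Word k)
nodeConcl ((r , _) , σ) = mapProp (subW σ) (concl r)

nodePrems : ∀ {n k} {J : InferenceSystem n k} → Node J → List (Prop n (Word k))
nodePrems ((r , _) , σ) = map (mapProp (subW σ)) (prem r)

record CoProof {n k} (J : InferenceSystem n k) (C : Prop n (Word k)) : Set where
  field
    tree   : List ℕ → Maybe (Node J)
    root   : Σ (Node J) λ nd → tree [] ≡ just nd × nodeConcl nd ≡ C
    closed : ∀ a nd → tree a ≡ just nd → (i : Fin (length (nodePrems nd))) →
             Σ (Node J) λ nd′ → tree (toℕ i ∷ a) ≡ just nd′ ×
               nodeConcl nd′ ≡ lookup (nodePrems nd) i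

-- Small step rules; premises (in x) are represented as sets of states.

data SRule (n k : ℕ) : Set where
  -- P₁(x) ⋯ Pₘ(x) / Q(γ x)
  intro   : Fin k → Subset n → Fin n → SRule n k
  -- / Q(ε)
  introε  : Fin n → SRule n k
  -- P₁(γ x)  P₂(x) ⋯ Pₘ(x) / Q(x)
  elim    : Fin k → Fin n → Subset n → Fin n → SRule n k
  -- P₁(x) ⋯ Pₘ(x) / Q(x)
  neutral : Subset n → Fin n → SRule n k

IsIntro : ∀ {n k} → SRule n k → Set
IsIntro (intro _ _ _)   = ⊤
IsIntro (introε _)      = ⊤
IsIntro (elim _ _ _ _)  = ⊥
IsIntro (neutral _ _)   = ⊥

elements : ∀ {n} → Subset n → List (Fin n)
elements {n} S = filter (_∈? S) (allFin n)

atomsAt : ∀ {n k} → Subset n → Tm k → List (Prop n (Tm k))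
atomsAt S t = map (λ P → atom P t) (elements S)

toRule : ∀ {n k} → SRule n k → Rule n k
toRule (intro γ S Q)    = atomsAt S x ⊢ atom Q (γ ∙ x)
toRule (introε Q)       = [] ⊢ atom Q ε
toRule (elim γ P S Q)   = (atom P (γ ∙ x) ∷ atomsAt S x) ⊢ atom Q x
toRule (neutral S Q)    = atomsAt S x ⊢ atom Q x

-- a small step alternating pushdown system is a finite set (list) of SRules

data Sat {n k} (I : List (SRule n k)) : SRule n k → Set where
  base : ∀ {r} → r ∈ₗ I → Sat I r
  sat1 : ∀ {γ S Q₁ T R} → Sat I (intro γ S Q₁) → Sat I (elim γ Q₁ T R) →
         Sat I (neutral (S ∪ T) R)
  sat2 : ∀ {γ U R} (f : Fin n → Subset n) → Sat I (neutral U R) →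
         (∀ Q → Q ∈ U → Sat I (intro γ (f Q) Q)) →
         Sat I (intro γ (⋃ (map f (elements U))) R)
  sat3 : ∀ {U R} → Sat I (neutral U R) →
         (∀ Q → Q ∈ U → Sat I (introε Q)) →
         Sat I (introε R)

Auto : ∀ {n k} → List (SRule n k) → SRule n k → Set
Auto I r = Sat I r × IsIntro r

⟦_⟧ : ∀ {n k} → (SRule n k → Set) → InferenceSystem n k
⟦ J ⟧ g = Σ (SRule _ _) λ r → J r × toRule r ≡ g

Tilde : ∀ {n k} → (SRule n k → Set) → InferenceSystem n k
Tilde {k = k} J g =
  (Σ (SRule _ _) λ r → J r × IsIntro r × toRule r ≡ g) ⊎
  (Σ (SRule _ _) λ r → J r × ¬ IsIntro r ×
     (instRule ε (toRule r) ≡ g ⊎ Σ (Fin k) λ γ → instRule (γ ∙ x) (toRule r) ≡ g))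

data CTerm {k} : Tm k → Set where
  cε : CTerm ε
  cγ : (γ : Fin k) → CTerm (γ ∙ x)

-- negation rules: ¬B from one ¬A chosen among the premises of each rule of J̃
-- with conclusion B (the choice is the function f on rules)
NegRule : ∀ {n k} → (SRule n k → Set) → InferenceSystem n k
NegRule {n} {k} J g =
  Σ (Fin n) λ P → Σ (Tm k) λ t → CTerm t × concl g ≡ ¬atom P t ×
  Σ (Rule n k → Fin n × Tm k) λ f →
    (∀ r → Tilde J r → concl r ≡ atom P t →
        atom (proj₁ (f r)) (proj₂ (f r)) ∈ₗ prem r) ×
    (∀ r → Tilde J r → concl r ≡ atom P t →
        ¬atom (proj₁ (f r)) (proj₂ (f r)) ∈ₗ prem g) ×
    (∀ L → L ∈ₗ prem g → Σ (Rule n k) λ r → Tilde J r × concl r ≡ atom P t ×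
        L ≡ ¬atom (proj₁ (f r)) (proj₂ (f r)))

Neg : ∀ {n k} → (SRule n k → Set) → InferenceSystem n k
Neg J g = ⟦ J ⟧ g ⊎ NegRule J g

-- Call P(w) J-derivable when it has a finite derivation by the rules of J̃ (Derivable).
-- The theorem is the chain
--   finite proof of ¬P(w) in I'_¬  ⇔  P(w) is not I'-derivable
--                                  ⇔  P(w) is not I-derivable         (saturation)
--                                  ⇔  co-inductive proof of ¬P(w) in I_¬.
-- The saturation theorem then says that every rule of I_s is admissible in I and every rule
-- of I is admissible in I' (Admissible, derivable-transfer), and I_s is decided by computing
-- it as a fixpoint over the finitely many small step rules (module Closure).
module Submission where

open import Defs
open import Data.Bool.Base using (Bool; true; false)
import Data.Bool.Properties as Bool
open import Data.Empty using (⊥; ⊥-elim)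
open import Data.Fin.Base using (Fin; toℕ)
import Data.Fin.Base as Fin
import Data.Fin.Properties as Fin
open import Data.Fin.Subset using (Subset; _∈_; _∪_; ⋃) renaming (⊥ to ∅)
open import Data.Fin.Subset.Properties using (x∈p∪q⁺; x∈p∪q⁻; ∉⊥; anySubset?)
  renaming (_∈?_ to _∈ˢ?_)
open import Data.List.Base
  using (List; []; _∷_; _++_; map; filter; allFin; concatMap; cartesianProduct; length; lookup)
open import Data.List.Properties using (filter-notAll; ∷-injectiveʳ; map-cong)
open import Data.List.Membership.Propositional using (find; lose)
  renaming (_∈_ to _∈ₗ_; _∉_ to _∉ₗ_)
open import Data.List.Membership.Propositional.Properties
  using (∈-map⁺; ∈-map⁻; ∈-++⁺ˡ; ∈-++⁺ʳ; ∈-filter⁺; ∈-filter⁻; ∈-allFin;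
         ∈-concatMap⁺; ∈-concatMap⁻; ∈-cartesianProduct⁺)
import Data.List.Membership.DecPropositional as DecMembership
open import Data.List.Relation.Unary.All as All using (All)
open import Data.List.Relation.Unary.Any as Any using (Any; here; there)
open import Data.List.Relation.Unary.Any.Properties using (lookup-index)
open import Data.Maybe.Base using (Maybe; just; nothing; _>>=_)
import Data.Maybe.Base as Maybe
open import Data.Nat.Base using (ℕ; zero; suc; _<_)
open import Data.Nat.Induction using (<-wellFounded)
open import Data.Product.Base using (Σ; ∃; _×_; _,_; proj₁; proj₂; uncurry)
import Data.Product.Properties as Product
open import Data.Sum.Base using (_⊎_; inj₁; inj₂)
import Data.Sum.Properties as Sum
open import Data.Unit.Base using (tt)
open import Data.Vec.Base using (Vec; []; _∷_; tabulate) renaming (lookup to lookupᵛ)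
import Data.Vec.Properties as Vec
open import Function.Base using (_∘_; id)
open import Function.Bundles using (_⇔_; mk⇔)
open import Induction.WellFounded using (Acc; acc)
open import Relation.Binary.Definitions using (DecidableEquality)
open import Relation.Binary.PropositionalEquality
  using (_≡_; _≢_; refl; sym; trans; cong; cong₂; subst; module ≡-Reasoning)
open import Relation.Nullary using (¬_; Dec; yes; no; ¬?)
open import Relation.Nullary.Decidable using (map′; _×-dec_; _→-dec_)
open import Relation.Unary using (Decidable)

private
  variable
    n k : ℕ
    X Y : Set

-- Finiteness.  The saturation is computed by search over the finitely many small step rules.

Enumeration : Set → Set
Enumeration X = Σ (List X) λ xs → ∀ a → a ∈ₗ xs

enum-Fin : ∀ m → Enumeration (Fin m)
enum-Fin m = allFin m , ∈-allFin

enum-× : Enumeration X → Enumeration Y → Enumeration (X × Y)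
enum-× (xs , ∈xs) (ys , ∈ys) =
  cartesianProduct xs ys , λ (a , b) → ∈-cartesianProduct⁺ (∈xs a) (∈ys b)

enum-⊎ : Enumeration X → Enumeration Y → Enumeration (X ⊎ Y)
enum-⊎ (xs , ∈xs) (ys , ∈ys) = map inj₁ xs ++ map inj₂ ys , λ where
  (inj₁ a) → ∈-++⁺ˡ (∈-map⁺ inj₁ (∈xs a))
  (inj₂ b) → ∈-++⁺ʳ (map inj₁ xs) (∈-map⁺ inj₂ (∈ys b))

enum-retract : (f : X → Y) (g : Y → X) → (∀ b → f (g b) ≡ b) →
               Enumeration X → Enumeration Y
enum-retract f g fg (xs , ∈xs) =
  map f xs , λ b → subst (_∈ₗ map f xs) (fg b) (∈-map⁺ f (∈xs (g b)))

enum-Bool : Enumeration Bool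
enum-Bool = true ∷ false ∷ [] , λ where
  true  → here refl
  false → there (here refl)

enum-Subset : ∀ m → Enumeration (Subset m)
enum-Subset zero    = [] ∷ [] , λ where [] → here refl
enum-Subset (suc m) =
  enum-retract (uncurry _∷_) (λ where (b ∷ S) → b , S) (λ where (_ ∷ _) → refl)
               (enum-× enum-Bool (enum-Subset m))

RuleCode : ℕ → ℕ → Set
RuleCode n k = (Fin k × Subset n × Fin n) ⊎ Fin n ⊎
               (Fin k × Fin n × Subset n × Fin n) ⊎ (Subset n × Fin n)

encode : SRule n k → RuleCode n k
encode (intro γ S Q)  = inj₁ (γ , S , Q)
encode (introε Q)     = inj₂ (inj₁ Q)
encode (elim γ P S Q) = inj₂ (inj₂ (inj₁ (γ , P , S , Q)))
encode (neutral S Q)  = inj₂ (inj₂ (inj₂ (S , Q)))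

decode : RuleCode n k → SRule n k
decode (inj₁ (γ , S , Q))                  = intro γ S Q
decode (inj₂ (inj₁ Q))                     = introε Q
decode (inj₂ (inj₂ (inj₁ (γ , P , S , Q)))) = elim γ P S Q
decode (inj₂ (inj₂ (inj₂ (S , Q))))         = neutral S Q

decode-encode : (r : SRule n k) → decode (encode r) ≡ r
decode-encode (intro _ _ _)  = refl
decode-encode (introε _)     = refl
decode-encode (elim _ _ _ _) = refl
decode-encode (neutral _ _)  = refl

_≟ˢ_ : DecidableEquality (Subset n)
_≟ˢ_ = Vec.≡-dec Bool._≟_

_≟ʳ_ : DecidableEquality (SRule n k)
r ≟ʳ r′ = map′ decoded (cong encode) (encode r ≟ᶜ encode r′)
  where
  open Product using (≡-dec)
  _≟ᶜ_ : DecidableEquality (RuleCode _ _)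
  _≟ᶜ_ = Sum.≡-dec (≡-dec Fin._≟_ (≡-dec _≟ˢ_ Fin._≟_))
        (Sum.≡-dec Fin._≟_
        (Sum.≡-dec (≡-dec Fin._≟_ (≡-dec Fin._≟_ (≡-dec _≟ˢ_ Fin._≟_)))
                   (≡-dec _≟ˢ_ Fin._≟_)))
  decoded : encode r ≡ encode r′ → r ≡ r′
  decoded e = trans (sym (decode-encode r)) (trans (cong decode e) (decode-encode r′))

_∈ʳ?_ : (r : SRule n k) (rs : List (SRule n k)) → Dec (r ∈ₗ rs)
r ∈ʳ? rs = DecMembership._∈?_ _≟ʳ_ r rs

enum-SRule : Enumeration (SRule n k)
enum-SRule {n} {k} = enum-retract decode encode decode-encode
  (enum-⊎ (enum-× (enum-Fin k) (enum-× (enum-Subset n) (enum-Fin n)))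
  (enum-⊎ (enum-Fin n)
  (enum-⊎ (enum-× (enum-Fin k) (enum-× (enum-Fin n) (enum-× (enum-Subset n) (enum-Fin n))))
          (enum-× (enum-Subset n) (enum-Fin n)))))

anyVec? : (∀ {P : X → Set} → Decidable P → Dec (∃ P)) →
          ∀ m {P : Vec X m → Set} → Decidable P → Dec (∃ P)
anyVec? any? zero    P? = map′ ([] ,_) (λ where ([] , p) → p) (P? [])
anyVec? any? (suc m) P? =
  map′ (λ (a , v , p) → a ∷ v , p) (λ where (a ∷ v , p) → a , v , p)
       (any? λ a → anyVec? any? m λ v → P? (a ∷ v))

choose : ∀ {S : Subset n} {R : Fin n → X → Set} → X →
         (∀ P → P ∈ S → Σ X (R P)) → Σ (Fin n → X) λ f → ∀ P → P ∈ S → R P (f P)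
choose {S = S} {R} default witness = (λ P → proj₁ (pick P)) , (λ P → proj₂ (pick P))
  where
  pick : ∀ P → Σ _ λ b → P ∈ S → R P b
  pick P with P ∈ˢ? S
  ... | yes p = proj₁ (witness P p) , λ _ → proj₂ (witness P p)
  ... | no ∉S = default , λ p → ⊥-elim (∉S p)

∈-elements⁺ : ∀ {S : Subset n} {P} → P ∈ S → P ∈ₗ elements S
∈-elements⁺ {S = S} {P} p = ∈-filter⁺ (_∈ˢ? S) (∈-allFin P) p

∈-elements⁻ : ∀ {S : Subset n} {P} → P ∈ₗ elements S → P ∈ S
∈-elements⁻ {n} {S} m = proj₂ (∈-filter⁻ (_∈ˢ? S) {xs = allFin n} m)

∈-⋃⁺ : (f : X → Subset n) (as : List X) {a : X} {P : Fin n} →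
       a ∈ₗ as → P ∈ f a → P ∈ ⋃ (map f as)
∈-⋃⁺ f (_ ∷ _)  (here refl) p = x∈p∪q⁺ (inj₁ p)
∈-⋃⁺ f (_ ∷ as) (there m)   p = x∈p∪q⁺ (inj₂ (∈-⋃⁺ f as m p))

∈-⋃⁻ : (f : X → Subset n) (as : List X) {P : Fin n} →
       P ∈ ⋃ (map f as) → Σ X λ a → a ∈ₗ as × P ∈ f a
∈-⋃⁻ f []       p = ⊥-elim (∉⊥ p)
∈-⋃⁻ f (a ∷ as) p with x∈p∪q⁻ (f a) (⋃ (map f as)) p
... | inj₁ q = a , here refl , q
... | inj₂ q with ∈-⋃⁻ f as q
...   | b , m , q′ = b , there m , q′

∈-atomsAt⁺ : ∀ {S : Subset n} {P} {u : Tm k} → P ∈ S → atom P u ∈ₗ atomsAt S u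
∈-atomsAt⁺ p = ∈-map⁺ _ (∈-elements⁺ p)

∈-atomsAt⁻ : ∀ {S : Subset n} {P} {s u : Tm k} → atom P s ∈ₗ atomsAt S u → P ∈ S × s ≡ u
∈-atomsAt⁻ m with ∈-map⁻ _ m
... | _ , m′ , refl = ∈-elements⁻ m′ , refl

atomsAt-mono : ∀ {S S′ : Subset n} {P} {s u : Tm k} → (∀ {Q} → Q ∈ S → Q ∈ S′) →
               atom P s ∈ₗ atomsAt S u → atom P s ∈ₗ atomsAt S′ u
atomsAt-mono S⊆S′ m with ∈-atomsAt⁻ m
... | p , refl = ∈-atomsAt⁺ (S⊆S′ p)

_≟ᵗ_ : DecidableEquality (Tm k)
ε       ≟ᵗ ε       = yes refl
x       ≟ᵗ x       = yes refl
(γ ∙ s) ≟ᵗ (δ ∙ t) =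
  map′ (λ (e , e′) → cong₂ _∙_ e e′) (λ where refl → refl , refl) (γ Fin.≟ δ ×-dec s ≟ᵗ t)
ε       ≟ᵗ x       = no λ ()
ε       ≟ᵗ (_ ∙ _) = no λ ()
x       ≟ᵗ ε       = no λ ()
x       ≟ᵗ (_ ∙ _) = no λ ()
(_ ∙ _) ≟ᵗ ε       = no λ ()
(_ ∙ _) ≟ᵗ x       = no λ ()

_≟ᵖ_ : DecidableEquality (Prop n (Tm k))
atom P s  ≟ᵖ atom Q t  = map′ (λ (e , e′) → cong₂ atom e e′) (λ where refl → refl , refl)
                              (P Fin.≟ Q ×-dec s ≟ᵗ t)
¬atom P s ≟ᵖ ¬atom Q t = map′ (λ (e , e′) → cong₂ ¬atom e e′) (λ where refl → refl , refl)
                              (P Fin.≟ Q ×-dec s ≟ᵗ t)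
atom _ _  ≟ᵖ ¬atom _ _ = no λ ()
¬atom _ _ ≟ᵖ atom _ _  = no λ ()

¬atom-injective : ∀ {P Q : Fin n} {v w : Word k} → ¬atom P v ≡ ¬atom Q w → P ≡ Q × v ≡ w
¬atom-injective refl = refl , refl

subW-subT : (σ : Word k) (t s : Tm k) → subW σ (subT t s) ≡ subW (subW σ t) s
subW-subT σ t ε       = refl
subW-subT σ t x       = refl
subW-subT σ t (γ ∙ s) = cong (γ ∷_) (subW-subT σ t s)

-- Every word w is σ(t) with t ∈ 𝒞, namely t = top w and σ = rest w (the top stack symbol
-- and the tail); and t is determined by the word (𝒞-injective).
top : Word k → Tm k
top []      = ε
top (γ ∷ _) = γ ∙ x

rest : Word k → Word k
rest []      = []
rest (_ ∷ w) = w

top-𝒞 : (w : Word k) → CTerm (top w)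
top-𝒞 []      = cε
top-𝒞 (γ ∷ _) = cγ γ

rest-top : (w : Word k) → subW (rest w) (top w) ≡ w
rest-top []      = refl
rest-top (_ ∷ _) = refl

rest-top-subT : (w : Word k) (s : Tm k) → subW (rest w) (subT (top w) s) ≡ subW w s
rest-top-subT w s = trans (subW-subT (rest w) (top w) s) (cong (λ v → subW v s) (rest-top w))

𝒞-injective : ∀ {t t′ : Tm k} {σ σ′} → CTerm t → CTerm t′ → subW σ t ≡ subW σ′ t′ → t ≡ t′
𝒞-injective cε     cε     _    = refl
𝒞-injective (cγ γ) (cγ δ) refl = refl

∈-instance⁻ : ∀ {A : Fin n} {s t : Tm k} {ps} → atom A s ∈ₗ map (mapProp (subT t)) ps →
              Σ (Tm k) λ s′ → atom A s′ ∈ₗ ps × s ≡ subT t s′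
∈-instance⁻ m with ∈-map⁻ _ m
... | atom _ s′ , m′ , refl = s′ , m′ , refl
... | ¬atom _ _ , _  , ()

atom-instance : ∀ {L : Prop n (Tm k)} {t Q u} → mapProp (subT t) L ≡ atom Q u →
                Σ (Tm k) λ c → L ≡ atom Q c × u ≡ subT t c
atom-instance {L = atom _ c}  refl = c , refl , refl
atom-instance {L = ¬atom _ _} ()

𝒞-instance : ∀ {h g : Rule n k} →
  (instRule ε h ≡ g ⊎ Σ (Fin k) λ γ → instRule (γ ∙ x) h ≡ g) →
  Σ (Tm k) λ t → CTerm t × instRule t h ≡ g
𝒞-instance (inj₁ e)       = ε , cε , e
𝒞-instance (inj₂ (γ , e)) = γ ∙ x , cγ γ , e

at-𝒞 : ∀ {h : Rule n k} {t} → CTerm t →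
  instRule ε h ≡ instRule t h ⊎ Σ (Fin k) λ γ → instRule (γ ∙ x) h ≡ instRule t h
at-𝒞 cε     = inj₁ refl
at-𝒞 (cγ γ) = inj₂ (γ , refl)

-- A non-introduction rule concludes at x, so its instance at t concludes at t.
instance-concl : ∀ {r : SRule n k} {t Q u} → ¬ IsIntro r →
                 mapProp (subT t) (concl (toRule r)) ≡ atom Q u → u ≡ t
instance-concl {r = intro _ _ _}  ni _    = ⊥-elim (ni tt)
instance-concl {r = introε _}     ni _    = ⊥-elim (ni tt)
instance-concl {r = elim _ _ _ _} _  refl = refl
instance-concl {r = neutral _ _}  _  refl = refl

tilde-𝒞 : ∀ {J : SRule n k → Set} {g Q t} → Tilde J g → concl g ≡ atom Q t → CTerm t
tilde-𝒞 (inj₁ (intro γ _ _ , _ , _ , refl)) refl = cγ γ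
tilde-𝒞 (inj₁ (introε _ , _ , _ , refl))    refl = cε
tilde-𝒞 (inj₁ (elim _ _ _ _ , _ , () , _))  _
tilde-𝒞 (inj₁ (neutral _ _ , _ , () , _))   _
tilde-𝒞 (inj₂ (_ , _ , ni , e)) ce with 𝒞-instance e
... | _ , c , refl = subst CTerm (sym (instance-concl ni ce)) c

premises-determined : ∀ {J : SRule n k → Set} {g Q t A s} {σ σ′ : Word k} →
  Tilde J g → concl g ≡ atom Q t → subW σ t ≡ subW σ′ t → atom A s ∈ₗ prem g →
  subW σ s ≡ subW σ′ s
premises-determined (inj₁ (intro _ _ _ , _ , _ , refl)) refl eq m with ∈-atomsAt⁻ m
... | _ , refl = ∷-injectiveʳ eq
premises-determined (inj₁ (introε _ , _ , _ , refl))   refl _ ()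
premises-determined (inj₁ (elim _ _ _ _ , _ , () , _)) _    _ _
premises-determined (inj₁ (neutral _ _ , _ , () , _))  _    _ _
premises-determined {σ = σ} {σ′} (inj₂ (_ , _ , ni , e)) ce eq m with 𝒞-instance e
... | t , _ , refl with instance-concl ni ce | ∈-instance⁻ m
... | refl | s′ , _ , refl = begin
  subW σ (subT t s′)   ≡⟨ subW-subT σ t s′ ⟩
  subW (subW σ t) s′   ≡⟨ cong (λ v → subW v s′) eq ⟩
  subW (subW σ′ t) s′  ≡⟨ subW-subT σ′ t s′ ⟨
  subW σ′ (subT t s′)  ∎
  where open ≡-Reasoning

data Derivable {n k} (J : SRule n k → Set) : Fin n → Word k → Set where
  derive : ∀ {g Q t} (σ : Word k) → Tilde J g → concl g ≡ atom Q t →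
           (∀ {A s} → atom A s ∈ₗ prem g → Derivable J A (subW σ s)) →
           Derivable J Q (subW σ t)

premises-at-x : ∀ {J : SRule n k → Set} {S : Subset n} {w} →
  (∀ P → P ∈ S → Derivable J P w) →
  ∀ {A s} → atom A s ∈ₗ atomsAt S x → Derivable J A (subW w s)
premises-at-x ds m with ∈-atomsAt⁻ m
... | p , refl = ds _ p

by-intro : ∀ {J : SRule n k → Set} {γ S Q w} → J (intro γ S Q) →
           (∀ P → P ∈ S → Derivable J P w) → Derivable J Q (γ ∷ w)
by-intro {w = w} j ds = derive w (inj₁ (_ , j , tt , refl)) refl (premises-at-x ds)

by-introε : ∀ {J : SRule n k → Set} {Q} → J (introε Q) → Derivable J Q []
by-introε j = derive [] (inj₁ (_ , j , tt , refl)) refl λ ()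

Admissible : ∀ {n k} → (SRule n k → Set) → Rule n k → Set
Admissible {k = k} J g = ∀ (σ : Word k) {Q t} → concl g ≡ atom Q t →
  (∀ {A s} → atom A s ∈ₗ prem g → Derivable J A (subW σ s)) → Derivable J Q (subW σ t)

tilde-admissible : ∀ {J : SRule n k → Set} {g} → Tilde J g → Admissible J g
tilde-admissible tr σ ce sub = derive σ tr ce sub

instance-admissible : ∀ {J : SRule n k → Set} {g t} → Admissible J g → Admissible J (instRule t g)
instance-admissible {J = J} {t = t} adm σ ce sub with atom-instance ce
... | c , cg , refl = subst (Derivable J _) (sym (subW-subT σ t c))
  (adm (subW σ t) cg λ m →
    subst (Derivable J _) (subW-subT σ t _) (sub (∈-map⁺ (mapProp (subT t)) m)))

admissible-from-instances : ∀ {J : SRule n k → Set} {g} →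
  (∀ {t} → CTerm t → Admissible J (instRule t g)) → Admissible J g
admissible-from-instances {J = J} {g} adm σ ce sub =
  subst (Derivable J _) (rest-top-subT σ _)
    (adm (top-𝒞 σ) (rest σ) (cong (mapProp (subT (top σ))) ce) premises)
  where
  premises : ∀ {A s} → atom A s ∈ₗ prem (instRule (top σ) g) → Derivable J A (subW (rest σ) s)
  premises m with ∈-instance⁻ m
  ... | s′ , m′ , refl = subst (Derivable J _) (sym (rest-top-subT σ s′)) (sub m′)

-- Rules of J are admissible for J: J̃ contains the introduction rules and the 𝒞-instances
-- of the others.
member-admissible : ∀ {J : SRule n k → Set} {r} → J r → Admissible J (toRule r)
member-admissible {r = intro _ _ _}      j = tilde-admissible (inj₁ (_ , j , tt , refl))
member-admissible {r = introε _}         j = tilde-admissible (inj₁ (_ , j , tt , refl))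
member-admissible {r = r@(elim _ _ _ _)} j =
  admissible-from-instances λ c → tilde-admissible (inj₂ (r , j , (λ ()) , at-𝒞 c))
member-admissible {r = r@(neutral _ _)}  j =
  admissible-from-instances λ c → tilde-admissible (inj₂ (r , j , (λ ()) , at-𝒞 c))

tilde-admissible-from : ∀ {J J′ : SRule n k → Set} {g} →
  (∀ {r} → J r → Admissible J′ (toRule r)) → Tilde J g → Admissible J′ g
tilde-admissible-from adm (inj₁ (_ , j , _ , refl)) = adm j
tilde-admissible-from adm (inj₂ (_ , j , _ , e)) with 𝒞-instance e
... | _ , _ , refl = instance-admissible (adm j)

derivable-transfer : ∀ {J J′ : SRule n k → Set} {Q w} →
  (∀ {r} → J r → Admissible J′ (toRule r)) → Derivable J Q w → Derivable J′ Q w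
derivable-transfer adm (derive σ tr ce sub) =
  tilde-admissible-from adm tr σ ce λ m → derivable-transfer adm (sub m)

-- Derivations when J consists of introduction rules only (an alternating multi-automaton):
-- they read the word from the top, so derivability is decided by recursion on the word.
module IntroductionOnly {n k} {J : SRule n k → Set} (intro-only : ∀ {r} → J r → IsIntro r) where

  view-ε : ∀ {Q w} → Derivable J Q w → w ≡ [] → J (introε Q)
  view-ε (derive _ (inj₁ (introε _ , j , _ , refl)) refl _)    _  = j
  view-ε (derive _ (inj₁ (intro _ _ _ , _ , _ , refl)) refl _) ()
  view-ε (derive _ (inj₁ (elim _ _ _ _ , _ , () , _)) _ _)     _
  view-ε (derive _ (inj₁ (neutral _ _ , _ , () , _)) _ _)      _
  view-ε (derive _ (inj₂ (_ , j , ni , _)) _ _)                _  = ⊥-elim (ni (intro-only j))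

  view-∷ : ∀ {Q w γ u} → Derivable J Q w → w ≡ γ ∷ u →
           Σ (Subset n) λ S → J (intro γ S Q) × (∀ P → P ∈ S → Derivable J P u)
  view-∷ (derive _ (inj₁ (intro _ S _ , j , _ , refl)) refl sub) refl =
    S , j , λ P p → sub (∈-atomsAt⁺ p)
  view-∷ (derive _ (inj₁ (introε _ , _ , _ , refl)) refl _)   ()
  view-∷ (derive _ (inj₁ (elim _ _ _ _ , _ , () , _)) _ _)    _
  view-∷ (derive _ (inj₁ (neutral _ _ , _ , () , _)) _ _)     _
  view-∷ (derive _ (inj₂ (_ , j , ni , _)) _ _)               _ = ⊥-elim (ni (intro-only j))

  intro-premise : ∀ {g Q t A s} → Tilde J g → concl g ≡ atom Q t → atom A s ∈ₗ prem g →
                  Σ (Fin k) λ γ → t ≡ γ ∙ x × s ≡ x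
  intro-premise (inj₁ (intro γ _ _ , _ , _ , refl)) refl m = γ , refl , proj₂ (∈-atomsAt⁻ m)
  intro-premise (inj₁ (introε _ , _ , _ , refl))    refl ()
  intro-premise (inj₁ (elim _ _ _ _ , _ , () , _))  _    _
  intro-premise (inj₁ (neutral _ _ , _ , () , _))   _    _
  intro-premise (inj₂ (_ , j , ni , _))             _    _ = ⊥-elim (ni (intro-only j))

  derivable? : Decidable J → ∀ Q w → Dec (Derivable J Q w)
  derivable? J? Q []      = map′ by-introε (λ d → view-ε d refl) (J? (introε Q))
  derivable? J? Q (γ ∷ u) = map′ (λ (_ , j , ds) → by-intro j ds) (λ d → view-∷ d refl)
    (anySubset? λ S → J? (intro γ S Q) ×-dec Fin.all? λ P → P ∈ˢ? S →-dec derivable? J? P u)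

-- Rules of J conclude atoms, so J_¬ derives a negation only with a negation rule.
rule-positive : ∀ (r : SRule n k) {σ P w} → mapProp (subW σ) (concl (toRule r)) ≢ ¬atom P w
rule-positive (intro _ _ _)  ()
rule-positive (introε _)     ()
rule-positive (elim _ _ _ _) ()
rule-positive (neutral _ _)  ()

negation-child : ∀ {J : SRule n k → Set} {h g σ₀ σ Q t} → NegRule J h → Tilde J g →
  concl g ≡ atom Q t → mapProp (subW σ₀) (concl h) ≡ ¬atom Q (subW σ t) →
  Σ (Fin n) λ A → Σ (Tm k) λ s →
    atom A s ∈ₗ prem g × ¬atom A (subW σ s) ∈ₗ map (mapProp (subW σ₀)) (prem h)
negation-child {g = g} {σ₀} (_ , _ , c₀ , ch , f , chosen , present , _) tr ce eq
  with ¬atom-injective (trans (cong (mapProp (subW σ₀)) (sym ch)) eq)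
... | refl , words with 𝒞-injective c₀ (tilde-𝒞 tr ce) words
... | refl = proj₁ (f g) , proj₂ (f g) , chosen g tr ce ,
  subst (λ v → ¬atom _ v ∈ₗ _) (premises-determined tr ce words (chosen g tr ce))
        (∈-map⁺ (mapProp (subW σ₀)) (present g tr ce))

-- A J-derivation of Q(w) refutes every finite proof of ¬Q(w) in J_¬: descend along the
-- derivation and the proof together, following the premise negated at each node.
refute-proof : ∀ {J : SRule n k → Set} {Q w} → Derivable J Q w → ¬ Proof (Neg J) (¬atom Q w)
refute-proof _ (node _ (inj₁ (r , _ , refl)) _ eq _) = rule-positive r eq
refute-proof (derive _ tr ce sub) (node _ (inj₂ ng) _ eq children) with negation-child ng tr ce eq
... | _ , _ , m , m¬ = refute-proof (sub m) (All.lookup children m¬)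

module _ {J : SRule n k → Set} {C : Prop n (Word k)} (cp : CoProof (Neg J) C) where
  open CoProof cp

  child-of : ∀ {a nd L} → tree a ≡ just nd → L ∈ₗ nodePrems nd →
             Σ (Node (Neg J)) λ nd′ → Σ ℕ λ i → tree (i ∷ a) ≡ just nd′ × nodeConcl nd′ ≡ L
  child-of {a} {nd} ta m with closed a nd ta (Any.index m)
  ... | nd′ , ta′ , eq′ = nd′ , _ , ta′ , trans eq′ (sym (lookup-index m))

  refute-node : ∀ {Q w a nd} → Derivable J Q w → tree a ≡ just nd → nodeConcl nd ≢ ¬atom Q w
  refute-node {nd = (_ , inj₁ (r , _ , refl)) , _} _ _ eq = rule-positive r eq
  refute-node {nd = (_ , inj₂ ng) , _} (derive _ tr ce sub) ta eq with negation-child ng tr ce eq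
  ... | _ , _ , m , m¬ with child-of ta m¬
  ... | _ , _ , ta′ , eq′ = refute-node (sub m) ta′ eq′

refute-coproof : ∀ {J : SRule n k → Set} {Q w} → Derivable J Q w → ¬ CoProof (Neg J) (¬atom Q w)
refute-coproof d cp with CoProof.root cp
... | _ , ta , eq = refute-node cp d ta eq

module _ {J : InferenceSystem n k} {C : Set} (prop : C → Prop n (Word k)) (node-at : C → Node J)
  (node-concl : ∀ c → nodeConcl (node-at c) ≡ prop c)
  (node-prem : ∀ c {L} → L ∈ₗ nodePrems (node-at c) → Σ C λ c′ → prop c′ ≡ L) where

  Labelling : List (Prop n (Word k)) → Set
  Labelling ps = ∀ {L} → L ∈ₗ ps → Σ C λ c → prop c ≡ L

  premiseAt : (ps : List (Prop n (Word k))) → Labelling ps → ℕ → Maybe C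
  premiseAt []       _   _       = nothing
  premiseAt (_ ∷ _)  lbl zero    = just (proj₁ (lbl (here refl)))
  premiseAt (_ ∷ ps) lbl (suc i) = premiseAt ps (λ m → lbl (there m)) i

  premiseAt-lookup : ∀ ps (lbl : Labelling ps) (i : Fin (length ps)) →
    Σ C λ c → premiseAt ps lbl (toℕ i) ≡ just c × prop c ≡ lookup ps i
  premiseAt-lookup (_ ∷ _)  lbl Fin.zero    = _ , refl , proj₂ (lbl (here refl))
  premiseAt-lookup (_ ∷ ps) lbl (Fin.suc i) = premiseAt-lookup ps (λ m → lbl (there m)) i

  reach : C → List ℕ → Maybe C
  reach c []      = just c
  reach c (i ∷ a) = reach c a >>= λ c′ → premiseAt (nodePrems (node-at c′)) (node-prem c′) i

  coproof-from-invariant : ∀ c → CoProof J (prop c)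
  coproof-from-invariant c = record
    { tree   = λ a → Maybe.map node-at (reach c a)
    ; root   = node-at c , refl , node-concl c
    ; closed = closed
    }
    where
    closed : ∀ a nd → Maybe.map node-at (reach c a) ≡ just nd → (i : Fin (length (nodePrems nd))) →
             Σ (Node J) λ nd′ → Maybe.map node-at (reach c (toℕ i ∷ a)) ≡ just nd′ ×
               nodeConcl nd′ ≡ lookup (nodePrems nd) i
    closed a nd eq i with reach c a
    closed a nd () i | nothing
    closed a .(node-at c′) refl i | just c′
      with premiseAt-lookup (nodePrems (node-at c′)) (node-prem c′) i
    ... | c″ , e , pc = node-at c″ , cong (Maybe.map node-at) e , trans (node-concl c″) pc

instances𝒞 : Rule n k → List (Rule n k)
instances𝒞 {k = k} h = instRule ε h ∷ map (λ γ → instRule (γ ∙ x) h) (allFin k)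

contributions : SRule n k → List (Rule n k)
contributions r@(intro _ _ _)  = toRule r ∷ []
contributions r@(introε _)     = toRule r ∷ []
contributions r@(elim _ _ _ _) = instances𝒞 (toRule r)
contributions r@(neutral _ _)  = instances𝒞 (toRule r)

∈-instances𝒞⁻ : ∀ {g h : Rule n k} → g ∈ₗ instances𝒞 h →
  instRule ε h ≡ g ⊎ Σ (Fin k) λ γ → instRule (γ ∙ x) h ≡ g
∈-instances𝒞⁻ (here refl) = inj₁ refl
∈-instances𝒞⁻ (there m) with ∈-map⁻ _ m
... | γ , _ , refl = inj₂ (γ , refl)

∈-instances𝒞⁺ : ∀ {g h : Rule n k} →
  (instRule ε h ≡ g ⊎ Σ (Fin k) λ γ → instRule (γ ∙ x) h ≡ g) → g ∈ₗ instances𝒞 h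
∈-instances𝒞⁺ (inj₁ refl)       = here refl
∈-instances𝒞⁺ (inj₂ (γ , refl)) = there (∈-map⁺ _ (∈-allFin γ))

∈-contributions⁻ : ∀ {J : SRule n k → Set} {r g} → J r → g ∈ₗ contributions r → Tilde J g
∈-contributions⁻ {r = intro _ _ _}  j (here refl) = inj₁ (_ , j , tt , refl)
∈-contributions⁻ {r = introε _}     j (here refl) = inj₁ (_ , j , tt , refl)
∈-contributions⁻ {r = r@(elim _ _ _ _)} j m = inj₂ (r , j , (λ ()) , ∈-instances𝒞⁻ {h = toRule r} m)
∈-contributions⁻ {r = r@(neutral _ _)}  j m = inj₂ (r , j , (λ ()) , ∈-instances𝒞⁻ {h = toRule r} m)

∈-contributions⁺ : ∀ {J : SRule n k → Set} {g} → Tilde J g →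
                   Σ (SRule n k) λ r → J r × g ∈ₗ contributions r
∈-contributions⁺ (inj₁ (intro _ _ _ , j , _ , refl))  = _ , j , here refl
∈-contributions⁺ (inj₁ (introε _ , j , _ , refl))     = _ , j , here refl
∈-contributions⁺ (inj₁ (elim _ _ _ _ , _ , () , _))
∈-contributions⁺ (inj₁ (neutral _ _ , _ , () , _))
∈-contributions⁺ (inj₂ (intro _ _ _ , _ , ni , _))    = ⊥-elim (ni tt)
∈-contributions⁺ (inj₂ (introε _ , _ , ni , _))       = ⊥-elim (ni tt)
∈-contributions⁺ (inj₂ (r@(elim _ _ _ _) , j , _ , e)) = r , j , ∈-instances𝒞⁺ {h = toRule r} e
∈-contributions⁺ (inj₂ (r@(neutral _ _) , j , _ , e))  = r , j , ∈-instances𝒞⁺ {h = toRule r} e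

module Refutations {n k} {J : SRule n k → Set} (J? : Decidable J)
  (derivable? : ∀ Q w → Dec (Derivable J Q w)) where

  tildeRules : List (Rule n k)
  tildeRules = concatMap contributions (filter J? (proj₁ enum-SRule))

  concluding : Fin n → Tm k → List (Rule n k)
  concluding Q t = filter (λ g → concl g ≟ᵖ atom Q t) tildeRules

  ∈-concluding⁻ : ∀ {g Q t} → g ∈ₗ concluding Q t → Tilde J g × concl g ≡ atom Q t
  ∈-concluding⁻ {Q = Q} {t} m with ∈-filter⁻ (λ g → concl g ≟ᵖ atom Q t) {xs = tildeRules} m
  ... | m′ , ce with find (∈-concatMap⁻ contributions {xs = filter J? (proj₁ enum-SRule)} m′)
  ... | _ , mr , mg = ∈-contributions⁻ (proj₂ (∈-filter⁻ J? {xs = proj₁ enum-SRule} mr)) mg , ce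

  ∈-concluding⁺ : ∀ {g Q t} → Tilde J g → concl g ≡ atom Q t → g ∈ₗ concluding Q t
  ∈-concluding⁺ {Q = Q} {t} tr ce with ∈-contributions⁺ tr
  ... | r , j , mg = ∈-filter⁺ (λ g → concl g ≟ᵖ atom Q t)
    (∈-concatMap⁺ contributions (lose (∈-filter⁺ J? (proj₂ enum-SRule r) j) mg)) ce

  RefutedPremise DerivablePremises : Word k → List (Prop n (Tm k)) → Set
  RefutedPremise σ ps =
    Σ (Fin n) λ A → Σ (Tm k) λ s → atom A s ∈ₗ ps × ¬ Derivable J A (subW σ s)
  DerivablePremises σ ps = ∀ {A s} → atom A s ∈ₗ ps → Derivable J A (subW σ s)

  refuted-or-derivable : ∀ σ ps → RefutedPremise σ ps ⊎ DerivablePremises σ ps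
  refuted-or-derivable σ [] = inj₂ λ ()
  refuted-or-derivable σ (atom A s ∷ ps) with derivable? A (subW σ s) | refuted-or-derivable σ ps
  ... | no ¬d | _                    = inj₁ (A , s , here refl , ¬d)
  ... | yes _ | inj₁ (B , u , m , ¬d) = inj₁ (B , u , there m , ¬d)
  ... | yes d | inj₂ ds              = inj₂ λ where
    (here refl) → d
    (there m)   → ds m
  refuted-or-derivable σ (¬atom _ _ ∷ ps) with refuted-or-derivable σ ps
  ... | inj₁ (B , u , m , ¬d) = inj₁ (B , u , there m , ¬d)
  ... | inj₂ ds              = inj₂ λ where
    (there m) → ds m

  -- the premise of g negated by the refutation rule at σ (with a default when there is none)
  pick : ∀ {σ ps} → Fin n × Tm k → RefutedPremise σ ps ⊎ DerivablePremises σ ps → Fin n × Tm k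
  pick _       (inj₁ (A , s , _)) = A , s
  pick default (inj₂ _)           = default

  choice : Word k → Fin n × Tm k → Rule n k → Fin n × Tm k
  choice σ default g = pick default (refuted-or-derivable σ (prem g))

  choice-refuted : ∀ {σ Q t g} → ¬ Derivable J Q (subW σ t) → Tilde J g → concl g ≡ atom Q t →
    atom (proj₁ (choice σ (Q , t) g)) (proj₂ (choice σ (Q , t) g)) ∈ₗ prem g ×
    ¬ Derivable J (proj₁ (choice σ (Q , t) g)) (subW σ (proj₂ (choice σ (Q , t) g)))
  choice-refuted {σ} {g = g} ¬d tr ce with refuted-or-derivable σ (prem g)
  ... | inj₁ (_ , _ , m , ¬dA) = m , ¬dA
  ... | inj₂ ds               = ⊥-elim (¬d (derive σ tr ce ds))

  refutation : Word k → Fin n → Tm k → Rule n k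
  refutation σ Q t = map (uncurry ¬atom ∘ choice σ (Q , t)) (concluding Q t) ⊢ ¬atom Q t

  refutation-negates : ∀ {σ Q t} → CTerm t → ¬ Derivable J Q (subW σ t) →
                       NegRule J (refutation σ Q t)
  refutation-negates {σ} {Q} {t} c ¬d = Q , t , c , refl , choice σ (Q , t) ,
    (λ _ tr ce → proj₁ (choice-refuted ¬d tr ce)) ,
    (λ _ tr ce → ∈-map⁺ _ (∈-concluding⁺ tr ce)) ,
    λ _ m → let g , mg , e = ∈-map⁻ _ m ; tr , ce = ∈-concluding⁻ mg in g , tr , ce , e

  refutation-premise : ∀ {σ Q t L} → ¬ Derivable J Q (subW σ t) → L ∈ₗ prem (refutation σ Q t) →
    Σ (Fin n) λ A → Σ (Tm k) λ s → L ≡ ¬atom A s × ¬ Derivable J A (subW σ s) ×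
      Σ (Rule n k) λ g → Tilde J g × concl g ≡ atom Q t × atom A s ∈ₗ prem g
  refutation-premise ¬d m with ∈-map⁻ _ m
  ... | g , mg , refl with ∈-concluding⁻ mg
  ... | tr , ce = _ , _ , refl , proj₂ (choice-refuted ¬d tr ce) , g , tr , ce ,
                  proj₁ (choice-refuted ¬d tr ce)

  refutation-at : ∀ {Q} w → ¬ Derivable J Q w → NegRule J (refutation (rest w) Q (top w))
  refutation-at {Q} w ¬d = refutation-negates (top-𝒞 w) (¬d ∘ subst (Derivable J Q) (rest-top w))

  refutation-node : ∀ {Q} w → ¬ Derivable J Q w → Node (Neg J)
  refutation-node {Q} w ¬d = (refutation (rest w) Q (top w) , inj₂ (refutation-at w ¬d)) , rest w

  refutation-node-concl : ∀ {Q} w (¬d : ¬ Derivable J Q w) →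
                          nodeConcl (refutation-node w ¬d) ≡ ¬atom Q w
  refutation-node-concl {Q} w _ = cong (¬atom Q) (rest-top w)

  refutation-node-premise : ∀ {Q} w (¬d : ¬ Derivable J Q w) {L} →
    L ∈ₗ nodePrems (refutation-node w ¬d) →
    Σ (Fin n) λ A → Σ (Tm k) λ s → L ≡ ¬atom A (subW (rest w) s) ×
      ¬ Derivable J A (subW (rest w) s) × Σ (Rule n k) λ g →
        Tilde J g × concl g ≡ atom Q (top w) × atom A s ∈ₗ prem g
  refutation-node-premise w ¬d m with ∈-map⁻ _ m
  ... | _ , mL , refl with refutation-premise (¬d ∘ subst (Derivable J _) (rest-top w)) mL
  ... | A , s , refl , ¬dA , rule = A , s , refl , ¬dA , rule

  -- Refutation nodes of underivable configurations form an invariant family.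
  underivable⇒coproof : ∀ {Q} w → ¬ Derivable J Q w → CoProof (Neg J) (¬atom Q w)
  underivable⇒coproof {Q} w ¬d =
    coproof-from-invariant prop node-at node-concl node-prem (Q , w , ¬d)
    where
    Underivable : Set
    Underivable = Σ (Fin n) λ Q → Σ (Word k) λ w → ¬ Derivable J Q w
    prop : Underivable → Prop n (Word k)
    prop (Q , w , _) = ¬atom Q w
    node-at : Underivable → Node (Neg J)
    node-at (_ , w , ¬d) = refutation-node w ¬d
    node-concl : ∀ c → nodeConcl (node-at c) ≡ prop c
    node-concl (_ , w , ¬d) = refutation-node-concl w ¬d
    node-prem : ∀ c {L} → L ∈ₗ nodePrems (node-at c) → Σ Underivable λ c′ → prop c′ ≡ L
    node-prem (_ , w , ¬d) m with refutation-node-premise w ¬d m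
    ... | A , s , refl , ¬dA , _ = (A , subW (rest w) s , ¬dA) , refl

  -- With introduction rules only, the premises of a refutation lie on the tail of the word,
  -- so refutations nest into a finite proof.
  module _ (intro-only : ∀ {r} → J r → IsIntro r) where
    open IntroductionOnly intro-only using (intro-premise)

    mutual
      underivable⇒proof : ∀ {Q} w → ¬ Derivable J Q w → Proof (Neg J) (¬atom Q w)
      underivable⇒proof {Q} w ¬d = node (refutation (rest w) Q (top w)) (inj₂ (refutation-at w ¬d))
        (rest w) (refutation-node-concl w ¬d) (All.tabulate (children w ¬d))

      children : ∀ {Q} w (¬d : ¬ Derivable J Q w) {L} → L ∈ₗ nodePrems (refutation-node w ¬d) →
                 Proof (Neg J) L
      children w ¬d m with refutation-node-premise w ¬d m
      ... | A , s , refl , ¬dA , g , tr , ce , mA with intro-premise tr ce mA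
      children []      _ _ | _ , _ , _ , _ , _ | _ , () , _
      children (_ ∷ u) _ _ | _ , _ , refl , ¬dA , _ | _ , refl , refl = underivable⇒proof u ¬dA

-- Elements enabled by a
-- step are added one at a time; `missing` lists every element not yet present and loses one
-- element per round, which bounds the number of rounds.
module Closure {X : Set} (_≟_ : DecidableEquality X) (Step : List X → X → Set)
  (step? : ∀ Ds a → Dec (Step Ds a)) (Good : X → Set)
  (good-step : ∀ {Ds a} → (∀ {b} → b ∈ₗ Ds → Good b) → Step Ds a → Good a) where
  open DecMembership _≟_ using (_∈?_)

  AllGood : List X → Set
  AllGood Ds = ∀ {b} → b ∈ₗ Ds → Good b

  Closure : List X → Set
  Closure Ds = Σ (List X) λ Es → AllGood Es × (∀ {b} → b ∈ₗ Ds → b ∈ₗ Es) ×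
                                  (∀ {a} → Step Es a → a ∈ₗ Es)

  grow : ∀ Ds missing → Acc _<_ (length missing) → AllGood Ds →
         (∀ {a} → a ∉ₗ Ds → a ∈ₗ missing) → Closure Ds
  grow Ds missing (acc smaller) good cover
    with Any.any? (λ a → ¬? (a ∈? Ds) ×-dec step? Ds a) missing
  ... | yes found = add (Any.satisfied found)
    where
    add : (Σ X λ a → a ∉ₗ Ds × Step Ds a) → Closure Ds
    add (a , a∉ , st) =
      let Es , goodEs , ⊆Es , closedEs = grow (a ∷ Ds) remaining (smaller shrinks) good′ cover′
      in Es , goodEs , (λ m → ⊆Es (there m)) , closedEs
      where
      remaining : List X
      remaining = filter (λ b → ¬? (b ≟ a)) missing
      shrinks : length remaining < length missing
      shrinks = filter-notAll (λ b → ¬? (b ≟ a)) missing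
                  (Any.map (λ where refl ¬¬ → ¬¬ refl) (cover a∉))
      good′ : AllGood (a ∷ Ds)
      good′ (here refl) = good-step good st
      good′ (there m)   = good m
      cover′ : ∀ {b} → b ∉ₗ a ∷ Ds → b ∈ₗ remaining
      cover′ b∉ = ∈-filter⁺ (λ b → ¬? (b ≟ a)) (cover (b∉ ∘ there)) (b∉ ∘ here)
  ... | no none = Ds , good , id , closed
    where
    closed : ∀ {a} → Step Ds a → a ∈ₗ Ds
    closed {a} st with a ∈? Ds
    ... | yes m  = m
    ... | no a∉ = ⊥-elim (none (Any.map (λ where refl → a∉ , st) (cover a∉)))

  closure : Enumeration X → ∀ Ds → AllGood Ds → Closure Ds
  closure (universe , complete) Ds good =
    grow Ds universe (<-wellFounded _) good λ {a} _ → complete a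

SatStep : List (SRule n k) → SRule n k → Set
SatStep {n} Ds (intro γ V R) = Σ (Subset n) λ U → Σ (Vec (Subset n) n) λ f →
  neutral U R ∈ₗ Ds × (∀ Q → Q ∈ U → intro γ (lookupᵛ f Q) Q ∈ₗ Ds) ×
  ⋃ (map (lookupᵛ f) (elements U)) ≡ V
SatStep {n} Ds (introε R) =
  Σ (Subset n) λ U → neutral U R ∈ₗ Ds × (∀ Q → Q ∈ U → introε Q ∈ₗ Ds)
SatStep Ds (elim _ _ _ _) = ⊥
SatStep {n} {k} Ds (neutral V R) =
  Σ (Fin k) λ γ → Σ (Subset n) λ S → Σ (Fin n) λ Q₁ → Σ (Subset n) λ T →
  intro γ S Q₁ ∈ₗ Ds × elim γ Q₁ T R ∈ₗ Ds × S ∪ T ≡ V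

satStep? : (Ds : List (SRule n k)) → Decidable (SatStep Ds)
satStep? {n} Ds (intro γ V R) = anySubset? λ U → anyVec? anySubset? n λ f →
  (neutral U R ∈ʳ? Ds) ×-dec
  Fin.all? (λ Q → Q ∈ˢ? U →-dec (intro γ (lookupᵛ f Q) Q ∈ʳ? Ds)) ×-dec
  (⋃ (map (lookupᵛ f) (elements U)) ≟ˢ V)
satStep? Ds (introε R) = anySubset? λ U →
  (neutral U R ∈ʳ? Ds) ×-dec Fin.all? λ Q → Q ∈ˢ? U →-dec (introε Q ∈ʳ? Ds)
satStep? Ds (elim _ _ _ _) = no λ ()
satStep? Ds (neutral V R) = Fin.any? λ γ → anySubset? λ S → Fin.any? λ Q₁ → anySubset? λ T →
  (intro γ S Q₁ ∈ʳ? Ds) ×-dec (elim γ Q₁ T R ∈ʳ? Ds) ×-dec ((S ∪ T) ≟ˢ V)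

module Saturation {n k} (I : List (SRule n k)) where

  satStep-sound : ∀ {Ds r} → (∀ {b} → b ∈ₗ Ds → Sat I b) → SatStep Ds r → Sat I r
  satStep-sound {r = intro _ _ _} sat (_ , f , mN , mI , refl) =
    sat2 (lookupᵛ f) (sat mN) λ Q q → sat (mI Q q)
  satStep-sound {r = introε _} sat (_ , mN , mI) = sat3 (sat mN) λ Q q → sat (mI Q q)
  satStep-sound {r = neutral _ _} sat (_ , _ , _ , _ , m₁ , m₂ , refl) = sat1 (sat m₁) (sat m₂)

  open Closure _≟ʳ_ SatStep satStep? (Sat I) satStep-sound using (closure)

  saturated : Σ (List (SRule n k)) _
  saturated = closure enum-SRule I base

  ∈-saturated : ∀ {r} → Sat I r → r ∈ₗ proj₁ saturated
  ∈-saturated (base m) = proj₁ (proj₂ (proj₂ saturated)) m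
  ∈-saturated (sat1 a b) = proj₂ (proj₂ (proj₂ saturated))
    (_ , _ , _ , _ , ∈-saturated a , ∈-saturated b , refl)
  ∈-saturated (sat2 {γ} {U} f a h) = proj₂ (proj₂ (proj₂ saturated))
    (U , tabulate f , ∈-saturated a ,
     (λ Q q → subst (λ S → intro γ S Q ∈ₗ _) (sym (Vec.lookup∘tabulate f Q))
                    (∈-saturated (h Q q))) ,
     cong ⋃ (map-cong (Vec.lookup∘tabulate f) (elements U)))
  ∈-saturated (sat3 a h) = proj₂ (proj₂ (proj₂ saturated))
    (_ , ∈-saturated a , λ Q q → ∈-saturated (h Q q))

  sat? : Decidable (Sat I)
  sat? r = map′ (proj₁ (proj₂ saturated)) ∈-saturated (r ∈ʳ? proj₁ saturated)

  auto? : Decidable (Auto I)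
  auto? r = sat? r ×-dec intro? r
    where
    intro? : Decidable IsIntro
    intro? (intro _ _ _)  = yes tt
    intro? (introε _)     = yes tt
    intro? (elim _ _ _ _) = no λ ()
    intro? (neutral _ _)  = no λ ()

  sat-admissible : ∀ {r} → Sat I r → Admissible (_∈ₗ I) (toRule r)
  sat-admissible (base m) = member-admissible m
  sat-admissible (sat1 a b) σ refl sub = sat-admissible b σ refl λ where
    (here refl) → sat-admissible a σ refl λ m → sub (atomsAt-mono (λ p → x∈p∪q⁺ (inj₁ p)) m)
    (there m)   → sub (atomsAt-mono (λ p → x∈p∪q⁺ (inj₂ p)) m)
  sat-admissible (sat2 {γ} {U} f a h) σ refl sub =
    sat-admissible a (γ ∷ σ) refl (premises-at-x λ Q q →
      sat-admissible (h Q q) σ refl λ m →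
        sub (atomsAt-mono (∈-⋃⁺ f (elements U) (∈-elements⁺ q)) m))
  sat-admissible (sat3 a h) σ refl _ =
    sat-admissible a [] refl (premises-at-x λ Q q → sat-admissible (h Q q) [] refl λ ())

  open IntroductionOnly {J = Auto I} proj₂ using (view-ε; view-∷; derivable?)

  Introduces : Fin k → Word k → Fin n → Subset n → Set
  Introduces γ u P S′ = Auto I (intro γ S′ P) × (∀ P′ → P′ ∈ S′ → Derivable (Auto I) P′ u)

  -- I'-derivability is closed under the neutral rules of I_s: on a word γ u the rule (2)
  -- combines the introduction rules deriving each premise, on ε the rule (3) does.
  neutral-auto : ∀ {S Q} → Sat I (neutral S Q) → Admissible (Auto I) (toRule (neutral S Q))
  neutral-auto s [] refl sub =
    by-introε (sat3 s (λ P p → proj₁ (view-ε (sub (∈-atomsAt⁺ p)) refl)) , tt)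
  neutral-auto {S} s (γ ∷ u) refl sub
    with choose {R = Introduces γ u} ∅ (λ P p → view-∷ (sub (∈-atomsAt⁺ p)) refl)
  ... | f , introduces =
    by-intro (sat2 f s (λ P p → proj₁ (proj₁ (introduces P p))) , tt) λ P′ p′ →
      let Q , mQ , p″ = ∈-⋃⁻ f (elements S) p′ in proj₂ (introduces Q (∈-elements⁻ mQ)) P′ p″

  -- An elimination rule of I_s, fed by the introduction rule deriving its first premise,
  -- is a neutral rule of I_s by (1).
  elim-auto : ∀ {γ P₁ S Q} → Sat I (elim γ P₁ S Q) → Admissible (Auto I) (toRule (elim γ P₁ S Q))
  elim-auto {S = S} s σ refl sub with view-∷ (sub (here refl)) refl
  ... | S₁ , (s₁ , _) , ds₁ = neutral-auto (sat1 s₁ s) σ refl (premises-at-x premises)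
    where
    premises : ∀ P → P ∈ S₁ ∪ S → Derivable (Auto I) P σ
    premises P p with x∈p∪q⁻ S₁ S p
    ... | inj₁ p₁ = ds₁ P p₁
    ... | inj₂ p₂ = sub (there (∈-atomsAt⁺ p₂))

  auto-admissible : ∀ {r} → Sat I r → Admissible (Auto I) (toRule r)
  auto-admissible {r = intro _ _ _}  s = member-admissible (s , tt)
  auto-admissible {r = introε _}     s = member-admissible (s , tt)
  auto-admissible {r = elim _ _ _ _} s = elim-auto s
  auto-admissible {r = neutral _ _}  s = neutral-auto s

  saturation-sound : ∀ {Q w} → Derivable (Auto I) Q w → Derivable (_∈ₗ I) Q w
  saturation-sound = derivable-transfer λ j → sat-admissible (proj₁ j)

  saturation-complete : ∀ {Q w} → Derivable (_∈ₗ I) Q w → Derivable (Auto I) Q w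
  saturation-complete = derivable-transfer λ m → auto-admissible (base m)

  auto-derivable? : ∀ Q w → Dec (Derivable (Auto I) Q w)
  auto-derivable? = derivable? auto?

  member-derivable? : ∀ Q w → Dec (Derivable (_∈ₗ I) Q w)
  member-derivable? Q w = map′ saturation-sound saturation-complete (auto-derivable? Q w)

theorem3 : ∀ {n k} (I : List (SRule n k)) (P : Fin n) (w : Word k) →
    Proof (Neg (Auto I)) (¬atom P w) ⇔ CoProof (Neg (λ r → r ∈ₗ I)) (¬atom P w)
theorem3 I P w = mk⇔
  (λ proof → Member.underivable⇒coproof w λ d → refute-proof (saturation-complete d) proof)
  (λ coproof → Automaton.underivable⇒proof proj₂ w λ d →
     refute-coproof (saturation-sound d) coproof)
  where
  open Saturation I
  module Automaton = Refutations auto? auto-derivable?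
  module Member = Refutations (_∈ʳ? I) member-derivable?
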